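{- Let $\Gamma$ be a finite link-regular simplicial graph with maximum clique size $d$, $\ell_0=|V\Gamma|$ and $\ell_k=|\mathrm{Lk}(\sigma)|$ for any $k$-clique $\sigma$ ($1\le k\le d$). Define integers $N_{m,k}$ for $1\le m\le d$, $0\le k\le m$ by $N_{m,m}=1$, $N_{m,m-1}=\ell_{m-1}-\ell_m-1$, and $N_{m,k}=\ell_{m-1}N_{m-1,k}-\ell_{k+1}N_{m,k+1}$ for $k<m-1$. Then \[ N_{m,k}=\begin{cases}\left(\prod_{k<j<m}\ell_j\right)\sum_{j=k}^{m}\binom{m-k}{j-k}(-1)^{j-k}\ell_j&\text{if }k<m-1,\\ \ell_{m-1}-\ell_m-1&\text{if }k=m-1,\\ 1&\text{if }k=m.\end{cases} \]
   Context: A $k$-clique is a set of $k$ pairwise adjacent vertices; $\mathrm{Lk}(\sigma)=\{v\notin\sigma\mid\sigma\cup\{v\}\text{ is a clique}\}$. $\Gamma$ is link-regular if cliques of equal size have links of equal size. -}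

module Defs where

open import Level using (0ℓ)
open import Data.Nat as ℕ using (ℕ; zero; suc; _≤_; _<_; _∸_)
open import Data.Nat.Combinatorics using (_C_)
open import Data.Integer as ℤ using (ℤ; +_; -_; _*_)
open import Data.Bool using (Bool)
open import Data.Fin using (Fin)
open import Data.Fin.Properties using (all?)
open import Data.Fin.Subset using (Subset; _∈_; _∉_; _∪_; ⁅_⁆; ∣_∣)
open import Data.Fin.Subset.Properties using (_∈?_)
open import Data.Vec using (tabulate)
open import Data.Product using (_×_; Σ; Σ-syntax)
open import Relation.Nullary using (Dec; ¬_; ⌊_⌋; yes; no)
open import Relation.Nullary.Decidable using (_×-dec_; _→-dec_; ¬?)
open import Relation.Binary.PropositionalEquality using (_≡_; _≢_)
open import Data.Fin using (_≟_)

record Graph : Set₁ where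
  field
    n     : ℕ
    Adj   : Fin n → Fin n → Set
    Adj?  : ∀ u v → Dec (Adj u v)
    sym   : ∀ {u v} → Adj u v → Adj v u
    irref : ∀ {u} → ¬ Adj u u

module _ (Γ : Graph) where
  open Graph Γ

  IsClique : Subset n → Set
  IsClique σ = ∀ u v → u ∈ σ → v ∈ σ → u ≢ v → Adj u v

  isClique? : (σ : Subset n) → Dec (IsClique σ)
  isClique? σ = all? λ u → all? λ v →
    (u ∈? σ) →-dec ((v ∈? σ) →-dec ((¬? (u ≟ v)) →-dec Adj? u v))

  IsKClique : ℕ → Subset n → Set
  IsKClique k σ = IsClique σ × ∣ σ ∣ ≡ k

  Lk : Subset n → Subset n
  Lk σ = tabulate λ v → ⌊ ¬? (v ∈? σ) ×-dec isClique? (σ ∪ ⁅ v ⁆) ⌋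

  LinkRegular : Set
  LinkRegular = ∀ σ τ → IsClique σ → IsClique τ → ∣ σ ∣ ≡ ∣ τ ∣ → ∣ Lk σ ∣ ≡ ∣ Lk τ ∣

  MaxCliqueSize : ℕ → Set
  MaxCliqueSize d = Σ[ σ ∈ Subset n ] IsKClique d σ × (∀ τ → IsClique τ → ∣ τ ∣ ≤ d)

sumℤ : ℕ → (ℕ → ℤ) → ℤ
sumℤ zero    f = + 0
sumℤ (suc m) f = sumℤ m f ℤ.+ f m

prodℤ : ℕ → (ℕ → ℤ) → ℤ
prodℤ zero    f = + 1
prodℤ (suc m) f = prodℤ m f * f m

module Submission where

open import Defs
open import Data.Nat as ℕ using (ℕ; suc; _≤_; _<_; _∸_)
open import Data.Nat.Combinatorics using (_C_)
open import Data.Integer as ℤ using (ℤ; +_; -_; _*_; _-_; _^_)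
open import Data.Fin.Subset using (Subset; ∣_∣)
open import Data.Product using (_×_)
open import Relation.Binary.PropositionalEquality using (_≡_)

open import Data.Nat using (zero; z≤n; s≤s)
open import Data.Nat.Properties
  using (+-identityʳ; +-suc; +-comm; n<1+n; <⇒≤; m≤n+m; m+n∸n≡m; m≤n⇒∃[o]m+o≡n)
open import Data.Nat.Combinatorics using (nCk+nC[k+1]≡[n+1]C[k+1]; k>n⇒nCk≡0)
import Data.Integer.Properties as ℤₚ
open import Data.Integer.Tactic.RingSolver using (solve-∀)
open import Data.Product using (_,_)
open import Function using (_∘_)
open import Relation.Binary.PropositionalEquality
  using (refl; sym; trans; cong; cong₂; subst; module ≡-Reasoning)

-- Write Δₙ f = Σᵢ C(n,i) (-1)ⁱ f(i), so that the claimed value of N m k is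
-- ℓ_{k+1} ⋯ ℓ_{m-1} · Δ_{m-k} (ℓ shifted by k). Pascal's rule gives
-- Δₙ₊₁ f = Δₙ f − Δₙ (f ∘ suc). Inducting on m − k, the recurrence
-- N m k = ℓ_{m-1} N (m-1) k − ℓ_{k+1} N m (k+1) presents both terms with the
-- same product ℓ_{k+1} ⋯ ℓ_{m-1} (taking ℓ_{m-1}, resp. ℓ_{k+1}, as the missing
-- factor), and what remains is exactly Pascal's rule for Δ. In the base case
-- m − k = 2 the two subdiagonal constants −1 cancel.

open ≡-Reasoning

sumℤ-cong : ∀ m {f g : ℕ → ℤ} → (∀ i → f i ≡ g i) → sumℤ m f ≡ sumℤ m g
sumℤ-cong zero    f≡g = refl
sumℤ-cong (suc m) f≡g = cong₂ ℤ._+_ (sumℤ-cong m f≡g) (f≡g m)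

prodℤ-cong : ∀ m {f g : ℕ → ℤ} → (∀ i → f i ≡ g i) → prodℤ m f ≡ prodℤ m g
prodℤ-cong zero    f≡g = refl
prodℤ-cong (suc m) f≡g = cong₂ _*_ (prodℤ-cong m f≡g) (f≡g m)

sumℤ-shift : ∀ m (f : ℕ → ℤ) → sumℤ (suc m) f ≡ f 0 ℤ.+ sumℤ m (f ∘ suc)
sumℤ-shift zero    f = trans (ℤₚ.+-identityˡ (f 0)) (sym (ℤₚ.+-identityʳ (f 0)))
sumℤ-shift (suc m) f = begin
  sumℤ (suc m) f ℤ.+ f (suc m)                    ≡⟨ cong (ℤ._+ f (suc m)) (sumℤ-shift m f) ⟩
  f 0 ℤ.+ sumℤ m (f ∘ suc) ℤ.+ f (suc m)          ≡⟨ ℤₚ.+-assoc (f 0) _ _ ⟩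
  f 0 ℤ.+ (sumℤ m (f ∘ suc) ℤ.+ f (suc m))        ∎

prodℤ-shift : ∀ m (f : ℕ → ℤ) → prodℤ (suc m) f ≡ f 0 * prodℤ m (f ∘ suc)
prodℤ-shift zero    f = trans (ℤₚ.*-identityˡ (f 0)) (sym (ℤₚ.*-identityʳ (f 0)))
prodℤ-shift (suc m) f = begin
  prodℤ (suc m) f * f (suc m)                     ≡⟨ cong (_* f (suc m)) (prodℤ-shift m f) ⟩
  f 0 * prodℤ m (f ∘ suc) * f (suc m)             ≡⟨ ℤₚ.*-assoc (f 0) _ _ ⟩
  f 0 * (prodℤ m (f ∘ suc) * f (suc m))           ∎

sumℤ-extend : ∀ m (f : ℕ → ℤ) → f m ≡ + 0 → sumℤ (suc m) f ≡ sumℤ m f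
sumℤ-extend m f fm≡0 = trans (cong (λ z → sumℤ m f ℤ.+ z) fm≡0) (ℤₚ.+-identityʳ (sumℤ m f))

sumℤ-- : ∀ m (f g : ℕ → ℤ) → sumℤ m (λ i → f i - g i) ≡ sumℤ m f - sumℤ m g
sumℤ-- zero    f g = refl
sumℤ-- (suc m) f g = begin
  sumℤ m (λ i → f i - g i) ℤ.+ (f m - g m)         ≡⟨ cong (ℤ._+ (f m - g m)) (sumℤ-- m f g) ⟩
  sumℤ m f - sumℤ m g ℤ.+ (f m - g m)              ≡⟨ regroup (sumℤ m f) (sumℤ m g) (f m) (g m) ⟩
  sumℤ m f ℤ.+ f m - (sumℤ m g ℤ.+ g m)            ∎
  where
  regroup : ∀ a b c d → a - b ℤ.+ (c - d) ≡ a ℤ.+ c - (b ℤ.+ d)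
  regroup = solve-∀

-- Δ n f is (-1)ⁿ times the n-th forward difference of f at 0.
binomialTerm : ℕ → (ℕ → ℤ) → ℕ → ℤ
binomialTerm n f i = + (n C i) * (- + 1) ^ i * f i

Δ : ℕ → (ℕ → ℤ) → ℤ
Δ n f = sumℤ (suc n) (binomialTerm n f)

Δ-cong : ∀ n {f g : ℕ → ℤ} → (∀ i → f i ≡ g i) → Δ n f ≡ Δ n g
Δ-cong n f≡g = sumℤ-cong (suc n) (λ i → cong (+ (n C i) * (- + 1) ^ i *_) (f≡g i))

binomialTerm-pascal : ∀ n f i →
  binomialTerm (suc n) f (suc i) ≡ binomialTerm n f (suc i) - binomialTerm n (f ∘ suc) i
binomialTerm-pascal n f i =
  trans (cong (λ c → + c * (- + 1) ^ suc i * f (suc i)) (sym (nCk+nC[k+1]≡[n+1]C[k+1] n i)))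
        (split (+ (n C i)) (+ (n C suc i)) ((- + 1) ^ i) (f (suc i)))
  where
  split : ∀ a b s x → (a ℤ.+ b) * (- + 1 * s) * x ≡ b * (- + 1 * s) * x - a * s * x
  split = solve-∀

binomialTerm-vanishes : ∀ n f → binomialTerm n f (suc n) ≡ + 0
binomialTerm-vanishes n f =
  trans (cong (λ c → + c * (- + 1) ^ suc n * f (suc n)) (k>n⇒nCk≡0 (n<1+n n)))
        (trans (cong (_* f (suc n)) (ℤₚ.*-zeroˡ ((- + 1) ^ suc n))) (ℤₚ.*-zeroˡ (f (suc n))))

Δ-suc : ∀ n f → Δ (suc n) f ≡ Δ n f - Δ n (f ∘ suc)
Δ-suc n f = begin
  Δ (suc n) f
    ≡⟨ sumℤ-shift (suc n) (binomialTerm (suc n) f) ⟩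
  t 0 ℤ.+ sumℤ (suc n) (λ i → binomialTerm (suc n) f (suc i))
    ≡⟨ cong (λ z → t 0 ℤ.+ z) (sumℤ-cong (suc n) (binomialTerm-pascal n f)) ⟩
  t 0 ℤ.+ sumℤ (suc n) (λ i → t (suc i) - binomialTerm n (f ∘ suc) i)
    ≡⟨ cong (λ z → t 0 ℤ.+ z) (sumℤ-- (suc n) (t ∘ suc) (binomialTerm n (f ∘ suc))) ⟩
  t 0 ℤ.+ (sumℤ (suc n) (t ∘ suc) - Δ n (f ∘ suc))
    ≡⟨ ℤₚ.+-assoc (t 0) _ _ ⟨
  t 0 ℤ.+ sumℤ (suc n) (t ∘ suc) - Δ n (f ∘ suc)
    ≡⟨ cong (_- Δ n (f ∘ suc)) (sumℤ-shift (suc n) t) ⟨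
  sumℤ (suc (suc n)) t - Δ n (f ∘ suc)
    ≡⟨ cong (_- Δ n (f ∘ suc)) (sumℤ-extend (suc n) t (binomialTerm-vanishes n f)) ⟩
  Δ n f - Δ n (f ∘ suc)
    ∎
  where
  t : ℕ → ℤ
  t = binomialTerm n f

Δ-zero : ∀ f → Δ 0 f ≡ f 0
Δ-zero f = trans (ℤₚ.+-identityˡ _) (ℤₚ.*-identityˡ (f 0))

Δ-two : ∀ f → Δ 2 f ≡ (f 0 - f 1) - (f 1 - f 2)
Δ-two f = begin
  Δ 2 f                                    ≡⟨ Δ-suc 1 f ⟩
  Δ 1 f - Δ 1 (f ∘ suc)                    ≡⟨ cong₂ _-_ (Δ-one f) (Δ-one (f ∘ suc)) ⟩
  (f 0 - f 1) - (f 1 - f 2)                ∎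
  where
  Δ-one : ∀ g → Δ 1 g ≡ g 0 - g 1
  Δ-one g = trans (Δ-suc 0 g) (cong₂ _-_ (Δ-zero g) (Δ-zero (g ∘ suc)))

factor-difference : ∀ x y p q a b → p * x ≡ y * q →
  x * (p * a) - y * (q * b) ≡ p * x * (a - b)
factor-difference x y p q a b px≡yq = begin
  x * (p * a) - y * (q * b)   ≡⟨ reassociate x y p q a b ⟩
  p * x * a - y * q * b       ≡⟨ cong (λ z → p * x * a - z * b) px≡yq ⟨
  p * x * a - p * x * b       ≡⟨ factorOut (p * x) a b ⟩
  p * x * (a - b)             ∎
  where
  reassociate : ∀ x y p q a b → x * (p * a) - y * (q * b) ≡ p * x * a - y * q * b
  reassociate = solve-∀
  factorOut : ∀ c a b → c * a - c * b ≡ c * (a - b)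
  factorOut = solve-∀

module Recurrence (d : ℕ) (ℓ : ℕ → ℕ) (N : ℕ → ℕ → ℤ)
    (N-subdiagonal : ∀ m → 1 ≤ m → m ≤ d → N m (m ∸ 1) ≡ + ℓ (m ∸ 1) - + ℓ m - + 1)
    (N-recurrence : ∀ m k → 1 ≤ m → m ≤ d → suc k < m
       → N m k ≡ + ℓ (m ∸ 1) * N (m ∸ 1) k - + ℓ (suc k) * N m (suc k)) where

  ℓᶻ : ℕ → ℤ
  ℓᶻ i = + ℓ i

  shiftedℓ : ℕ → ℕ → ℤ
  shiftedℓ k i = ℓᶻ (k ℕ.+ i)

  linkProduct : ℕ → ℕ → ℤ
  linkProduct k n = prodℤ (suc n) (λ i → ℓᶻ (suc k ℕ.+ i))

  shiftedℓ-suc : ∀ k i → shiftedℓ k (suc i) ≡ shiftedℓ (suc k) i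
  shiftedℓ-suc k i = cong ℓᶻ (+-suc k i)

  linkProduct-zero : ∀ k → linkProduct k 0 ≡ ℓᶻ (suc k)
  linkProduct-zero k = trans (ℤₚ.*-identityˡ _) (cong ℓᶻ (+-identityʳ (suc k)))

  linkProduct-snoc : ∀ k n → linkProduct k n * ℓᶻ (suc (suc (n ℕ.+ k))) ≡ linkProduct k (suc n)
  linkProduct-snoc k n =
    cong (λ j → linkProduct k n * ℓᶻ j) (cong suc (sym (trans (+-suc k n) (cong suc (+-comm k n)))))

  linkProduct-cons : ∀ k n → linkProduct k (suc n) ≡ ℓᶻ (suc k) * linkProduct (suc k) n
  linkProduct-cons k n = trans (prodℤ-shift (suc n) (λ i → ℓᶻ (suc k ℕ.+ i)))
    (cong₂ _*_ (cong ℓᶻ (+-identityʳ (suc k)))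
               (prodℤ-cong (suc n) (cong (ℓᶻ ∘ suc) ∘ +-suc k)))

  Δ-two-shiftedℓ : ∀ k → Δ 2 (shiftedℓ k) ≡ (ℓᶻ k - ℓᶻ (suc k)) - (ℓᶻ (suc k) - ℓᶻ (suc (suc k)))
  Δ-two-shiftedℓ k = trans (Δ-two (shiftedℓ k)) (cong₂ _-_
    (cong₂ _-_ (cong ℓᶻ (+-identityʳ k)) (cong ℓᶻ (+-comm k 1)))
    (cong₂ _-_ (cong ℓᶻ (+-comm k 1)) (cong ℓᶻ (+-comm k 2))))

  Δ-shiftedℓ-suc : ∀ n k → Δ (suc n) (shiftedℓ k) ≡ Δ n (shiftedℓ k) - Δ n (shiftedℓ (suc k))
  Δ-shiftedℓ-suc n k = trans (Δ-suc n (shiftedℓ k))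
    (cong (λ z → Δ n (shiftedℓ k) - z) (Δ-cong n (shiftedℓ-suc k)))

  N-closedForm-byGap : ∀ n k → suc (suc (n ℕ.+ k)) ≤ d →
    N (suc (suc (n ℕ.+ k))) k ≡ linkProduct k n * Δ (suc (suc n)) (shiftedℓ k)
  N-closedForm-byGap zero k m≤d = begin
      N (suc (suc k)) k
    ≡⟨ N-recurrence (suc (suc k)) k (s≤s z≤n) m≤d (s≤s (s≤s (m≤n+m k 0))) ⟩
      ℓᶻ (suc k) * N (suc k) k - ℓᶻ (suc k) * N (suc (suc k)) (suc k)
    ≡⟨ cong₂ (λ x y → ℓᶻ (suc k) * x - ℓᶻ (suc k) * y)
             (N-subdiagonal (suc k) (s≤s z≤n) (<⇒≤ m≤d)) (N-subdiagonal (suc (suc k)) (s≤s z≤n) m≤d) ⟩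
      ℓᶻ (suc k) * (ℓᶻ k - ℓᶻ (suc k) - + 1) - ℓᶻ (suc k) * (ℓᶻ (suc k) - ℓᶻ (suc (suc k)) - + 1)
    ≡⟨ unitsCancel (ℓᶻ (suc k)) (ℓᶻ k - ℓᶻ (suc k)) (ℓᶻ (suc k) - ℓᶻ (suc (suc k))) ⟩
      ℓᶻ (suc k) * ((ℓᶻ k - ℓᶻ (suc k)) - (ℓᶻ (suc k) - ℓᶻ (suc (suc k))))
    ≡⟨ cong₂ _*_ (linkProduct-zero k) (Δ-two-shiftedℓ k) ⟨
      linkProduct k 0 * Δ 2 (shiftedℓ k)
    ∎
    where
    unitsCancel : ∀ x a b → x * (a - + 1) - x * (b - + 1) ≡ x * (a - b)
    unitsCancel = solve-∀
  N-closedForm-byGap (suc n) k m≤d = begin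
      N m k
    ≡⟨ N-recurrence m k (s≤s z≤n) m≤d (s≤s (s≤s (m≤n+m k (suc n)))) ⟩
      L * N (suc (suc (n ℕ.+ k))) k - ℓᶻ (suc k) * N m (suc k)
    ≡⟨ cong₂ (λ x y → L * x - ℓᶻ (suc k) * y) (N-closedForm-byGap n k (<⇒≤ m≤d)) closedForm-right ⟩
      L * (linkProduct k n * A) - ℓᶻ (suc k) * (linkProduct (suc k) n * B)
    ≡⟨ factor-difference L (ℓᶻ (suc k)) (linkProduct k n) (linkProduct (suc k) n) A B
         (trans (linkProduct-snoc k n) (linkProduct-cons k n)) ⟩
      linkProduct k n * L * (A - B)
    ≡⟨ cong₂ _*_ (linkProduct-snoc k n) (sym (Δ-shiftedℓ-suc (suc (suc n)) k)) ⟩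
      linkProduct k (suc n) * Δ (suc (suc (suc n))) (shiftedℓ k)
    ∎
    where
    m : ℕ
    m = suc (suc (suc n ℕ.+ k))
    L A B : ℤ
    L = ℓᶻ (suc (suc (n ℕ.+ k)))
    A = Δ (suc (suc n)) (shiftedℓ k)
    B = Δ (suc (suc n)) (shiftedℓ (suc k))
    m≡ : suc (suc (n ℕ.+ suc k)) ≡ m
    m≡ = cong (suc ∘ suc) (+-suc n k)
    closedForm-right : N m (suc k) ≡ linkProduct (suc k) n * B
    closedForm-right = subst (λ j → N j (suc k) ≡ linkProduct (suc k) n * B) m≡
      (N-closedForm-byGap n (suc k) (subst (_≤ d) (sym m≡) m≤d))

  N-closedForm : ∀ m k → m ≤ d → suc k < m →
    N m k ≡ prodℤ (m ∸ k ∸ 1) (λ i → ℓᶻ (suc k ℕ.+ i)) * Δ (m ∸ k) (shiftedℓ k)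
  N-closedForm m k m≤d k+1<m with o , refl ← m≤n⇒∃[o]m+o≡n k+1<m
    rewrite +-comm k o | m+n∸n≡m (suc (suc o)) k = N-closedForm-byGap o k m≤d

-- The graph enters only through the recurrence defining N; its hypotheses are unused.
lemma6p9 : (Γ : Graph) → LinkRegular Γ → (d : ℕ) → MaxCliqueSize Γ d
    → (ℓ : ℕ → ℕ) → ℓ 0 ≡ Graph.n Γ
    → (∀ k → 1 ≤ k → k ≤ d → (σ : Subset (Graph.n Γ)) → IsKClique Γ k σ → ∣ Lk Γ σ ∣ ≡ ℓ k)
    → (N : ℕ → ℕ → ℤ)
    → (∀ m → 1 ≤ m → m ≤ d → N m m ≡ + 1)
    → (∀ m → 1 ≤ m → m ≤ d → N m (m ∸ 1) ≡ + ℓ (m ∸ 1) - + ℓ m - + 1)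
    → (∀ m k → 1 ≤ m → m ≤ d → suc k < m
         → N m k ≡ + ℓ (m ∸ 1) * N (m ∸ 1) k - + ℓ (suc k) * N m (suc k))
    → ∀ m k → 1 ≤ m → m ≤ d → k ≤ m
    → (suc k < m
         → N m k ≡ prodℤ (m ∸ k ∸ 1) (λ i → + ℓ (suc k ℕ.+ i))
                   * sumℤ (suc (m ∸ k)) (λ i → + ((m ∸ k) C i) * (- + 1) ^ i * + ℓ (k ℕ.+ i)))
      × (suc k ≡ m → N m k ≡ + ℓ (m ∸ 1) - + ℓ m - + 1)
      × (k ≡ m → N m k ≡ + 1)
lemma6p9 _ _ d _ ℓ _ _ N N-diagonal N-subdiagonal N-recurrence m k 1≤m m≤d _ =
  Recurrence.N-closedForm d ℓ N N-subdiagonal N-recurrence m k m≤d , subdiagonal , diagonal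
  where
  subdiagonal : suc k ≡ m → N m k ≡ + ℓ (m ∸ 1) - + ℓ m - + 1
  subdiagonal refl = N-subdiagonal (suc k) 1≤m m≤d
  diagonal : k ≡ m → N m k ≡ + 1
  diagonal refl = N-diagonal k 1≤m m≤d
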